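{- Let $n$ be a positive integer and let $\mathcal{B}$ be a balanced bipartite graph on $2n$ vertices. If $\delta(\mathcal{B})\geq \frac{n}{2}+1$, then $f(\mathcal{B})=n+1$.
   Context: All graphs are finite and simple. A balanced bipartite graph on $2n$ vertices is a bipartite graph with a bipartition into two parts $V_1,V_2$ with $|V_1|=|V_2|=n$. $\delta(G)$ denotes the minimum degree of $G$. The forest number $f(G)$ is the maximum cardinality of a set $S\subseteq V(G)$ such that the induced subgraph $G[S]$ is a forest (acyclic). -}

module Defs where

open import Data.Nat using (ℕ; _+_; _*_; _≤_)
open import Data.Fin using (Fin)
open import Data.Fin.Subset using (Subset; _∈_; ∣_∣; ∁)
open import Data.Bool using (Bool; true; false)
open import Data.Vec using (tabulate)
open import Data.List using (List; []; _∷_; _++_; [_]; length)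
open import Data.List.Relation.Unary.All using (All)
open import Data.List.Relation.Unary.Unique.Propositional using (Unique)
open import Data.Product using (Σ; _×_; ∃)
open import Data.Unit using (⊤)
open import Relation.Binary.PropositionalEquality using (_≡_)
open import Relation.Nullary using (¬_)

record Graph (m : ℕ) : Set where
  field
    adj   : Fin m → Fin m → Bool
    sym   : ∀ u v → adj u v ≡ adj v u
    irrefl : ∀ v → adj v v ≡ false
open Graph public

deg : ∀ {m} → Graph m → Fin m → ℕ
deg G v = ∣ tabulate (adj G v) ∣

IsBalancedBipartite : ∀ {m} → ℕ → Graph m → Set
IsBalancedBipartite {m} n G =
  Σ (Subset m) λ P →
    (∣ P ∣ ≡ n) × (∣ ∁ P ∣ ≡ n) ×
    (∀ u v → adj G u v ≡ true → u ∈ P → v ∈ P → Data.Empty.⊥) ×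
    (∀ u v → adj G u v ≡ true → ¬ (u ∈ P) → ¬ (v ∈ P) → Data.Empty.⊥)
  where import Data.Empty

ConsecAdj : ∀ {m} → Graph m → List (Fin m) → Set
ConsecAdj G (x ∷ y ∷ r) = (adj G x y ≡ true) × ConsecAdj G (y ∷ r)
ConsecAdj G _ = ⊤

IsCycle : ∀ {m} → Graph m → List (Fin m) → Set
IsCycle G [] = Data.Empty.⊥ where import Data.Empty
IsCycle G (x ∷ xs) =
  (3 ≤ length (x ∷ xs)) × Unique (x ∷ xs) × ConsecAdj G ((x ∷ xs) ++ [ x ])

InducesForest : ∀ {m} → Graph m → Subset m → Set
InducesForest G S = ¬ (Σ (List _) λ c → IsCycle G c × All (_∈ S) c)

ForestNumber≡ : ∀ {m} → Graph m → ℕ → Set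
ForestNumber≡ {m} G k =
  (Σ (Subset m) λ S → InducesForest G S × ∣ S ∣ ≡ k) ×
  (∀ (S : Subset m) → InducesForest G S → ∣ S ∣ ≤ k)

-- Lower bound: one part together with a single vertex of the other part induces
-- a star plus isolated vertices, hence a forest on n + 1 vertices.
--
-- Upper bound: suppose S induces a forest and |S| ≥ n + 2.  Let X be the part
-- that S meets less, Y the other one, q = |S ∩ X| ≤ p = |S ∩ Y| and
-- r = |Y ∖ S| = n − p.  A vertex of S ∩ X has all its neighbours in Y, so at
-- least (n + 2)/2 − r of them lie in S; summing, G[S] has at least
-- q ((n + 2)/2 − r) edges, whereas a forest on p + q vertices has at most
-- p + q − 1.  As p + q ≥ n + 2 forces q ≥ r + 2, the two bounds contradict
-- each other.  The edge bound for forests is proved by deleting leaves; a leaf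
-- exists because if every vertex of S has two neighbours in S, a path in S
-- can be extended until it runs into itself and closes a cycle.

module Submission where

open import Defs hiding (sym)
open import Data.Nat using (ℕ; zero; suc; _+_; _*_; _≤_; _≰_; _<_; z≤n; s≤s; _≤?_)
open import Data.Nat.Properties hiding (_≟_)
open import Data.Nat.Tactic.RingSolver using (solve-∀)
open import Data.Bool using (Bool; true; false; not; _∧_; _∨_)
open import Data.Bool.Properties using (not-involutive; ∧-comm; ∧-conicalʳ) renaming (_≟_ to _≟ᵇ_)
open import Data.Fin using (Fin; zero; suc)
open import Data.Fin.Properties using (_≟_; any?; pigeonhole) renaming (<⇒≢ to <ᶠ⇒≢)
open import Data.Fin.Subset using (Subset; ∣_∣; ∁) renaming (_∈_ to _∈ˢ_)
open import Data.Vec using (lookup; tabulate)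
open import Data.Vec.Properties using (tabulate∘lookup; lookup∘tabulate; lookup-map; lookup⇒[]=; []=⇒lookup)
open import Data.List using (List; []; _∷_; _++_; [_]; length)
import Data.List as List
open import Data.List.Properties using (++-assoc; length-++)
open import Data.List.Relation.Unary.All using (All; []; _∷_)
import Data.List.Relation.Unary.All as All
import Data.List.Relation.Unary.All.Properties as All
open import Data.List.Relation.Unary.AllPairs using ([]; _∷_)
open import Data.List.Relation.Unary.Unique.Propositional using (Unique)
open import Data.List.Membership.Propositional.Properties using (∈-lookup; ∈-∃++)
open import Data.Product using (Σ; ∃; _×_; _,_; proj₂)
open import Data.Sum using (_⊎_; inj₁; inj₂)
open import Data.Empty using (⊥; ⊥-elim)
open import Data.Unit using (tt)
open import Function using (_∘_)
open import Relation.Binary.PropositionalEquality hiding ([_])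
open import Relation.Nullary using (¬_; yes; no; contradiction)
open import Relation.Nullary.Decidable using (does; _×-dec_; ¬?)
open import Algebra.Properties.CommutativeMonoid.Sum +-0-commutativeMonoid
  using (sum; sum-syntax; ∑-distrib-+; ∑-comm; sum-cong-≗; sum-replicate-zero)
open import Algebra.Properties.Semiring.Sum +-*-semiring using (*-distribˡ-sum)

-- Sums over vertex sets, which are Boolean functions on Fin m

𝟙 : Bool → ℕ
𝟙 true  = 1
𝟙 false = 0

𝟙≤1 : ∀ b → 𝟙 b ≤ 1
𝟙≤1 true  = ≤-refl
𝟙≤1 false = z≤n

∑-mono-≤ : ∀ {m} {f g : Fin m → ℕ} → (∀ i → f i ≤ g i) → sum f ≤ sum g
∑-mono-≤ {zero}  _   = z≤n
∑-mono-≤ {suc m} f≤g = +-mono-≤ (f≤g zero) (∑-mono-≤ (λ i → f≤g (suc i)))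

module _ {m : ℕ} where

  sumOver : (Fin m → Bool) → (Fin m → ℕ) → ℕ
  sumOver s f = ∑[ i < m ] (𝟙 (s i) * f i)

  card : (Fin m → Bool) → ℕ
  card s = sumOver s (λ _ → 1)

  -- 'does' rather than '⌊_⌋', so that ⁅ suc v ⁆ (suc i) reduces to ⁅ v ⁆ i.
  ⁅_⁆ : Fin m → Fin m → Bool
  ⁅ v ⁆ i = does (v ≟ i)

  _∖_ : (Fin m → Bool) → Fin m → Fin m → Bool
  (s ∖ v) i = not (⁅ v ⁆ i) ∧ s i

  _∩_ : (Fin m → Bool) → (Fin m → Bool) → Fin m → Bool
  (s ∩ t) i = s i ∧ t i

  _∪_ : (Fin m → Bool) → (Fin m → Bool) → Fin m → Bool
  (s ∪ t) i = s i ∨ t i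

  ⁅⁆-self : ∀ v → ⁅ v ⁆ v ≡ true
  ⁅⁆-self v with v ≟ v
  ... | yes _   = refl
  ... | no v≢v = contradiction refl v≢v

  ∖⊆ : ∀ s v i → (s ∖ v) i ≡ true → s i ≡ true
  ∖⊆ s v i h with v ≟ i
  ... | no _ = h

  ⁅⁆∪⁻ : ∀ {u t i} → (⁅ u ⁆ ∪ t) i ≡ true → u ≡ i ⊎ t i ≡ true
  ⁅⁆∪⁻ {u} {i = i} h with u ≟ i
  ... | yes u≡i = inj₁ u≡i
  ... | no _    = inj₂ h

  sumOver-cong : ∀ s {f g} → (∀ i → f i ≡ g i) → sumOver s f ≡ sumOver s g
  sumOver-cong s f≗g = sum-cong-≗ (λ i → cong (𝟙 (s i) *_) (f≗g i))

  card-cong : ∀ {s t} → (∀ i → s i ≡ t i) → card s ≡ card t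
  card-cong s≗t = sum-cong-≗ (λ i → cong (λ b → 𝟙 b * 1) (s≗t i))

  sumOver-mono : ∀ s {f g} → (∀ i → s i ≡ true → f i ≤ g i) → sumOver s f ≤ sumOver s g
  sumOver-mono s {f} {g} f≤g = ∑-mono-≤ pointwise
    where
    pointwise : ∀ i → 𝟙 (s i) * f i ≤ 𝟙 (s i) * g i
    pointwise i with s i in si
    ... | true  = +-monoˡ-≤ 0 (f≤g i si)
    ... | false = z≤n

  sumOver-⊆ : ∀ {s t} f → (∀ i → s i ≡ true → t i ≡ true) → sumOver s f ≤ sumOver t f
  sumOver-⊆ {s} {t} f s⊆t = ∑-mono-≤ pointwise
    where
    pointwise : ∀ i → 𝟙 (s i) * f i ≤ 𝟙 (t i) * f i
    pointwise i with s i in si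
    ... | false = z≤n
    ... | true rewrite s⊆t i si = ≤-refl

  sumOver-+ : ∀ s f g → sumOver s (λ i → f i + g i) ≡ sumOver s f + sumOver s g
  sumOver-+ s f g = trans (sum-cong-≗ (λ i → *-distribˡ-+ (𝟙 (s i)) (f i) (g i))) (∑-distrib-+ (λ i → 𝟙 (s i) * f i) _)

  sumOver-*ˡ : ∀ s c f → sumOver s (λ i → c * f i) ≡ c * sumOver s f
  sumOver-*ˡ s c f = trans (sum-cong-≗ (λ i → x*[c*y]≡c*[x*y] (𝟙 (s i)) c (f i))) (sym (*-distribˡ-sum c (λ i → 𝟙 (s i) * f i)))
    where
    x*[c*y]≡c*[x*y] : ∀ x c y → x * (c * y) ≡ c * (x * y)
    x*[c*y]≡c*[x*y] = solve-∀

  sumOver-const : ∀ s c → sumOver s (λ _ → c) ≡ c * card s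
  sumOver-const s c = trans (sumOver-cong s (λ _ → sym (*-identityʳ c))) (sumOver-*ˡ s c _)

  card-split : ∀ s t → card s ≡ card (s ∩ t) + card (s ∩ (not ∘ t))
  card-split s t = trans (sum-cong-≗ split) (∑-distrib-+ (λ i → 𝟙 (s i ∧ t i) * 1) _)
    where
    split : ∀ i → 𝟙 (s i) * 1 ≡ 𝟙 (s i ∧ t i) * 1 + 𝟙 (s i ∧ not (t i)) * 1
    split i with s i | t i
    ... | true  | true  = refl
    ... | true  | false = refl
    ... | false | _     = refl

  card-nonempty : ∀ s → 1 ≤ card s → ∃ λ v → s v ≡ true
  card-nonempty s 1≤|s| with any? (λ v → s v ≟ᵇ true)
  ... | yes found = found
  ... | no none   = contradiction (≤-trans 1≤|s| (≤-trans (sumOver-mono s (λ i si → contradiction (i , si) none))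
                                                          (≤-reflexive (sumOver-const s 0)))) λ ()

sumOver-⁅⁆ : ∀ {m} (v : Fin m) f → sumOver ⁅ v ⁆ f ≡ f v
sumOver-⁅⁆ {suc m} zero    f = trans (cong₂ _+_ (+-identityʳ (f zero)) (sum-replicate-zero m)) (+-identityʳ (f zero))
sumOver-⁅⁆ {suc m} (suc v) f = sumOver-⁅⁆ v (λ i → f (suc i))

card-⁅⁆ : ∀ {m} (v : Fin m) → card ⁅ v ⁆ ≡ 1
card-⁅⁆ v = sumOver-⁅⁆ v (λ _ → 1)

sumOver-∖ : ∀ {m} (s : Fin m → Bool) v f → s v ≡ true → sumOver s f ≡ sumOver (s ∖ v) f + f v
sumOver-∖ s v f sv =
  trans (sum-cong-≗ split) (trans (∑-distrib-+ (λ i → 𝟙 ((s ∖ v) i) * f i) _) (cong (sumOver (s ∖ v) f +_) (sumOver-⁅⁆ v f)))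
  where
  split : ∀ i → 𝟙 (s i) * f i ≡ 𝟙 ((s ∖ v) i) * f i + 𝟙 (⁅ v ⁆ i) * f i
  split i with v ≟ i
  ... | yes refl rewrite sv = refl
  ... | no _ = sym (+-identityʳ _)

card-∖ : ∀ {m} (s : Fin m → Bool) v → s v ≡ true → card s ≡ suc (card (s ∖ v))
card-∖ s v sv = trans (sumOver-∖ s v (λ _ → 1) sv) (+-comm (card (s ∖ v)) 1)


card-⁅⁆∪ : ∀ {m} (u : Fin m) t → t u ≡ false → card (⁅ u ⁆ ∪ t) ≡ suc (card t)
card-⁅⁆∪ u t tu = trans (card-∖ (⁅ u ⁆ ∪ t) u (cong (_∨ t u) (⁅⁆-self u))) (cong suc (card-cong removeU))
  where
  removeU : ∀ i → ((⁅ u ⁆ ∪ t) ∖ u) i ≡ t i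
  removeU i with u ≟ i
  ... | yes refl = sym tu
  ... | no _     = refl

Unique-++⁻ˡ : ∀ {A : Set} (xs : List A) {ys} → Unique (xs ++ ys) → Unique xs
Unique-++⁻ˡ []       _          = []
Unique-++⁻ˡ (x ∷ xs) (x∉ ∷ xs!) = All.++⁻ˡ xs x∉ ∷ Unique-++⁻ˡ xs xs!

Unique⇒lookup-injective : ∀ {A : Set} {xs : List A} → Unique xs →
                          ∀ i j → List.lookup xs i ≡ List.lookup xs j → i ≡ j
Unique⇒lookup-injective (x∉ ∷ _)   zero    zero    _  = refl
Unique⇒lookup-injective (x∉ ∷ _)   zero    (suc j) eq = contradiction eq (All.lookup x∉ (∈-lookup j))
Unique⇒lookup-injective (x∉ ∷ _)   (suc i) zero    eq = contradiction (sym eq) (All.lookup x∉ (∈-lookup i))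
Unique⇒lookup-injective (_  ∷ xs!) (suc i) (suc j) eq = cong suc (Unique⇒lookup-injective xs! i j eq)

Unique⇒length≤ : ∀ {m} (xs : List (Fin m)) → Unique xs → length xs ≤ m
Unique⇒length≤ {m} xs xs! with length xs ≤? m
... | yes ok = ok
... | no tooLong with pigeonhole (≰⇒> tooLong) (List.lookup xs)
...   | i , j , i<j , eq = contradiction (Unique⇒lookup-injective xs! i j eq) (<ᶠ⇒≢ i<j)

Independent : ∀ {m} → Graph m → (Fin m → Bool) → Set
Independent G x = ∀ u v → adj G u v ≡ true → x u ≡ true → x v ≡ true → ⊥

-- Degrees inside a vertex set

module _ {m} (G : Graph m) where

  open import Data.List.Membership.DecPropositional (_≟_ {m}) using (_∈?_)

  adj⇒≢ : ∀ {u v} → adj G u v ≡ true → u ≢ v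
  adj⇒≢ {u} uv refl = contradiction (trans (sym uv) (irrefl G u)) λ ()

  degIn : (Fin m → Bool) → Fin m → ℕ
  degIn s v = sumOver s (λ j → 𝟙 (adj G v j))

  -- twice the number of edges of G[s]
  degSum : (Fin m → Bool) → ℕ
  degSum s = sumOver s (degIn s)

  degIn≤card : ∀ s v → degIn s v ≤ card s
  degIn≤card s v = sumOver-mono s (λ j _ → 𝟙≤1 (adj G v j))

  degIn-∖ : ∀ s v i → s v ≡ true → degIn s i ≡ degIn (s ∖ v) i + 𝟙 (adj G i v)
  degIn-∖ s v i sv = sumOver-∖ s v (λ j → 𝟙 (adj G i j)) sv

  degIn-∖-self : ∀ s v → s v ≡ true → degIn s v ≡ degIn (s ∖ v) v
  degIn-∖-self s v sv =
    trans (degIn-∖ s v v sv) (trans (cong (λ b → degIn (s ∖ v) v + 𝟙 b) (irrefl G v)) (+-identityʳ _))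

  degSum≤card² : ∀ s → degSum s ≤ card s * card s
  degSum≤card² s = ≤-trans (sumOver-mono s (λ i _ → degIn≤card s i)) (≤-reflexive (sumOver-const s (card s)))

  degSum-∖ : ∀ s v → s v ≡ true → degSum s ≤ degSum (s ∖ v) + 2 * degIn s v
  degSum-∖ s v sv = begin
    degSum s                                                        ≡⟨ sumOver-∖ s v (degIn s) sv ⟩
    sumOver (s ∖ v) (degIn s) + d                                   ≡⟨ cong (_+ d) (sumOver-cong (s ∖ v) (λ i → degIn-∖ s v i sv)) ⟩
    sumOver (s ∖ v) (λ i → degIn (s ∖ v) i + 𝟙 (adj G i v)) + d    ≡⟨ cong (_+ d) (sumOver-+ (s ∖ v) (degIn (s ∖ v)) _) ⟩
    degSum (s ∖ v) + sumOver (s ∖ v) (λ i → 𝟙 (adj G i v)) + d     ≤⟨ +-monoˡ-≤ d (+-monoʳ-≤ (degSum (s ∖ v)) edgesToV) ⟩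
    degSum (s ∖ v) + d + d                                          ≡⟨ +-assoc (degSum (s ∖ v)) d d ⟩
    degSum (s ∖ v) + (d + d)                                        ≡⟨ cong (λ e → degSum (s ∖ v) + (d + e)) (sym (+-identityʳ d)) ⟩
    degSum (s ∖ v) + 2 * d                                          ∎
    where
    open ≤-Reasoning
    d = degIn s v
    edgesToV : sumOver (s ∖ v) (λ i → 𝟙 (adj G i v)) ≤ d
    edgesToV = ≤-trans (≤-reflexive (sumOver-cong (s ∖ v) (λ i → cong 𝟙 (Graph.sym G i v))))
                       (sumOver-⊆ (λ j → 𝟙 (adj G v j)) (∖⊆ s v))

  -- Paths and cycles

  CycleIn : (Fin m → Bool) → Set
  CycleIn s = Σ (List (Fin m)) λ c → IsCycle G c × All (λ i → s i ≡ true) c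

  Acyclic : (Fin m → Bool) → Set
  Acyclic s = ¬ CycleIn s

  Acyclic-⊆ : ∀ {s t} → (∀ i → t i ≡ true → s i ≡ true) → Acyclic s → Acyclic t
  Acyclic-⊆ t⊆s acyclic (c , cycle , c⊆t) = acyclic (c , cycle , All.map (λ {i} → t⊆s i) c⊆t)

  PathIn : (Fin m → Bool) → List (Fin m) → Set
  PathIn s xs = Unique xs × ConsecAdj G xs × All (λ i → s i ≡ true) xs

  ConsecAdj-++⁻ˡ : ∀ xs {ys} → ConsecAdj G (xs ++ ys) → ConsecAdj G xs
  ConsecAdj-++⁻ˡ []           _       = tt
  ConsecAdj-++⁻ˡ (x ∷ [])     _       = tt
  ConsecAdj-++⁻ˡ (x ∷ y ∷ xs) (e , c) = e , ConsecAdj-++⁻ˡ (y ∷ xs) c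

  ConsecAdj-∷ʳ : ∀ xs {z w} → ConsecAdj G (xs ++ [ z ]) → adj G z w ≡ true →
                 ConsecAdj G ((xs ++ [ z ]) ++ [ w ])
  ConsecAdj-∷ʳ []           _        e = e , tt
  ConsecAdj-∷ʳ (x ∷ [])     (e′ , _) e = e′ , e , tt
  ConsecAdj-∷ʳ (x ∷ y ∷ xs) (e′ , c) e = e′ , ConsecAdj-∷ʳ (y ∷ xs) c e

  PathIn-++⁻ˡ : ∀ {s} xs {ys} → PathIn s (xs ++ ys) → PathIn s xs
  PathIn-++⁻ˡ xs (xs! , c , a) = Unique-++⁻ˡ xs xs! , ConsecAdj-++⁻ˡ xs c , All.++⁻ˡ xs a

  closePath : ∀ {s} x xs z → PathIn s (x ∷ xs ++ [ z ]) → 1 ≤ length xs → adj G z x ≡ true → CycleIn s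
  closePath x xs z (xs! , c , a) 1≤|xs| zx = x ∷ xs ++ [ z ] , (3≤ , xs! , ConsecAdj-∷ʳ (x ∷ xs) c zx) , a
    where
    3≤ : 3 ≤ length (x ∷ xs ++ [ z ])
    3≤ = s≤s (subst (2 ≤_) (sym (length-++ xs)) (+-monoˡ-≤ 1 1≤|xs|))

  cycleAtRepeat : ∀ {s} x y rest ys z zs → x ∷ y ∷ rest ≡ ys ++ z ∷ zs → PathIn s (x ∷ y ∷ rest) →
                  z ≢ x → z ≢ y → adj G x z ≡ true → CycleIn s
  cycleAtRepeat x y rest []           z zs refl _    z≢x _   _  = contradiction refl z≢x
  cycleAtRepeat x y rest (_ ∷ [])     z zs refl _    _   z≢y _  = contradiction refl z≢y
  cycleAtRepeat x y rest (_ ∷ _ ∷ ys) z zs refl path _   _   xz =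
    closePath x (y ∷ ys) z (PathIn-++⁻ˡ ((x ∷ y ∷ ys) ++ [ z ]) (subst (PathIn _) (sym (++-assoc (x ∷ y ∷ ys) [ z ] zs)) path))
              (s≤s z≤n) (trans (Graph.sym G z x) xz)

  otherNeighbour : ∀ {s v} → 2 ≤ degIn s v → ∀ y → ∃ λ z → z ≢ y × adj G v z ≡ true × s z ≡ true
  otherNeighbour {s} {v} 2≤d y with any? (λ z → ¬? (z ≟ y) ×-dec (adj G v z ≟ᵇ true ×-dec s z ≟ᵇ true))
  ... | yes found = found
  ... | no none   = contradiction (≤-trans 2≤d (≤-trans (∑-mono-≤ onlyY) (≤-reflexive (card-⁅⁆ y)))) λ { (s≤s ()) }
    where
    onlyY : ∀ j → 𝟙 (s j) * 𝟙 (adj G v j) ≤ 𝟙 (⁅ y ⁆ j) * 1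
    onlyY j with s j in sj | adj G v j in vj
    ... | false | _     = z≤n
    ... | true  | false = z≤n
    ... | true  | true with y ≟ j
    ...   | yes _   = ≤-refl
    ...   | no y≢j = contradiction (j , y≢j ∘ sym , vj , sj) none

  module _ {s : Fin m → Bool} (minDeg≥2 : ∀ v → s v ≡ true → 2 ≤ degIn s v) where

    -- k is fuel: a path has distinct vertices, so it cannot outgrow m.
    extendPath : ∀ k x y rest → PathIn s (x ∷ y ∷ rest) → m < length (x ∷ y ∷ rest) + k → CycleIn s
    extendPath zero    x y rest (xs! , _) long =
      contradiction (≤-trans (≤-reflexive (+-identityʳ _)) (Unique⇒length≤ _ xs!)) (<⇒≱ long)
    extendPath (suc k) x y rest path@(xs! , c , a) long with otherNeighbour (minDeg≥2 x (All.head a)) y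
    ... | z , z≢y , xz , sz with z ∈? (x ∷ y ∷ rest)
    ...   | yes z∈path with ys , zs , eq ← ∈-∃++ z∈path =
            cycleAtRepeat x y rest ys z zs eq path (adj⇒≢ xz ∘ sym) z≢y xz
    ...   | no z∉path =
            extendPath k z x (y ∷ rest) (All.¬Any⇒All¬ _ z∉path ∷ xs! , (trans (Graph.sym G z x) xz , c) , sz ∷ a)
                       (≤-trans long (≤-reflexive (+-suc _ k)))

    minDegree≥2⇒cycle : ∀ {v} → s v ≡ true → CycleIn s
    minDegree≥2⇒cycle {v} sv with otherNeighbour (minDeg≥2 v sv) v
    ... | z , z≢v , vz , sz =
      extendPath m z v [] ((z≢v ∷ []) ∷ [] ∷ [] , (trans (Graph.sym G z v) vz , tt) , sz ∷ sv ∷ []) (s≤s (n≤1+n m))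

  -- A forest on k + 1 vertices has at most k edges

  leaf : ∀ s {v} → Acyclic s → s v ≡ true → ∃ λ w → s w ≡ true × degIn s w ≤ 1
  leaf s acyclic sv with any? (λ w → (s w ≟ᵇ true) ×-dec (degIn s w ≤? 1))
  ... | yes found = found
  ... | no none   = contradiction (minDegree≥2⇒cycle (λ w sw → ≰⇒> (λ d≤1 → none (w , sw , d≤1))) sv) acyclic

  removeLeaf : ∀ s {k} → Acyclic s → card s ≡ suc k →
               ∃ λ v → card (s ∖ v) ≡ k × degIn s v ≤ 1 × degIn s v ≤ k × degSum s ≤ degSum (s ∖ v) + 2 * degIn s v
  removeLeaf s {k} acyclic |s| with leaf s acyclic (proj₂ (card-nonempty s (≤-trans (s≤s z≤n) (≤-reflexive (sym |s|)))))
  ... | v , sv , d≤1 = v , |s∖v| , d≤1 , d≤k , degSum-∖ s v sv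
    where
    |s∖v| : card (s ∖ v) ≡ k
    |s∖v| = suc-injective (trans (sym (card-∖ s v sv)) |s|)
    d≤k : degIn s v ≤ k
    d≤k = ≤-trans (≤-reflexive (degIn-∖-self s v sv)) (subst (degIn (s ∖ v) v ≤_) |s∖v| (degIn≤card (s ∖ v) v))

  forest-degSum≤ : ∀ k {s} → Acyclic s → card s ≡ suc k → degSum s ≤ 2 * k
  forest-degSum≤ zero {s} acyclic |s| with removeLeaf s acyclic |s|
  ... | v , |s∖v| , _ , d≤0 , step = ≤-trans step (+-mono-≤ noEdgesLeft (*-monoʳ-≤ 2 d≤0))
    where
    noEdgesLeft : degSum (s ∖ v) ≤ 0
    noEdgesLeft = subst (λ c → degSum (s ∖ v) ≤ c * c) |s∖v| (degSum≤card² (s ∖ v))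
  forest-degSum≤ (suc k) {s} acyclic |s| with removeLeaf s acyclic |s|
  ... | v , |s∖v| , d≤1 , _ , step =
    ≤-trans step (≤-trans (+-mono-≤ (forest-degSum≤ k (Acyclic-⊆ (∖⊆ s v) acyclic) |s∖v|) (*-monoʳ-≤ 2 d≤1))
                          (≤-reflexive (trans (+-comm (2 * k) 2) (sym (*-suc 2 k)))))

  forest-degSum+2≤ : ∀ s → Acyclic s → 1 ≤ card s → degSum s + 2 ≤ 2 * card s
  forest-degSum+2≤ s acyclic 1≤|s| with card s in |s|
  ... | suc k = ≤-trans (+-monoˡ-≤ 2 (forest-degSum≤ k acyclic |s|))
                        (≤-reflexive (trans (+-comm (2 * k) 2) (sym (*-suc 2 k))))

  -- Stars are forests

  successorOnCycle : ∀ {s : Fin m → Bool} x₀ x₁ x₂ r → x₀ ≢ x₁ → All (x₁ ≢_) r → ConsecAdj G (x₂ ∷ r ++ [ x₀ ]) →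
                     s x₀ ≡ true → All (λ i → s i ≡ true) r → ∃ λ w → w ≢ x₁ × adj G x₂ w ≡ true × s w ≡ true
  successorOnCycle x₀ x₁ x₂ []      x₀≢x₁ _          (e , _) s₀ _        = x₀ , x₀≢x₁ , e , s₀
  successorOnCycle x₀ x₁ x₂ (w ∷ r) _     (x₁≢w ∷ _) (e , _) _  (sw ∷ _) = w , x₁≢w ∘ sym , e , sw

  star-acyclic : ∀ {s : Fin m → Bool} u → (∀ i j → adj G i j ≡ true → s i ≡ true → s j ≡ true → i ≡ u ⊎ j ≡ u) → Acyclic s
  star-acyclic u _ ([] , () , _)
  star-acyclic u _ (_ ∷ [] , (s≤s () , _) , _)
  star-acyclic u _ (_ ∷ _ ∷ [] , (s≤s (s≤s ()) , _) , _)
  star-acyclic u star (x₀ ∷ x₁ ∷ x₂ ∷ r , (_ , (x₀∉ ∷ x₁∉ ∷ _) , e₀₁ , e₁₂ , closing) , s₀ ∷ s₁ ∷ s₂ ∷ sr)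
    with successorOnCycle x₀ x₁ x₂ r (All.head x₀∉) (All.tail x₁∉) closing s₀ sr
  ... | w , w≢x₁ , e₂w , sw with star x₁ x₂ e₁₂ s₁ s₂ | star x₂ w e₂w s₂ sw | star x₀ x₁ e₀₁ s₀ s₁
  ... | inj₁ x₁≡u | inj₁ x₂≡u | _         = All.head x₁∉ (trans x₁≡u (sym x₂≡u))
  ... | inj₁ x₁≡u | inj₂ w≡u  | _         = w≢x₁ (trans w≡u (sym x₁≡u))
  ... | inj₂ x₂≡u | _         | inj₁ x₀≡u = All.head (All.tail x₀∉) (trans x₀≡u (sym x₂≡u))
  ... | inj₂ x₂≡u | _         | inj₂ x₁≡u = All.head x₁∉ (trans x₁≡u (sym x₂≡u))

  ⁅⁆∪independent-acyclic : ∀ {y} u → Independent G y → Acyclic (⁅ u ⁆ ∪ y)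
  ⁅⁆∪independent-acyclic {y} u y-indep = star-acyclic u incident
    where
    incident : ∀ i j → adj G i j ≡ true → (⁅ u ⁆ ∪ y) i ≡ true → (⁅ u ⁆ ∪ y) j ≡ true → i ≡ u ⊎ j ≡ u
    incident i j e si sj with ⁅⁆∪⁻ {u = u} {t = y} si | ⁅⁆∪⁻ {u = u} {t = y} sj
    ... | inj₁ u≡i | _        = inj₁ (sym u≡i)
    ... | inj₂ _   | inj₁ u≡j = inj₂ (sym u≡j)
    ... | inj₂ yi  | inj₂ yj  = ⊥-elim (y-indep i j e yi yj)

-- Counting edges of a forest in a balanced bipartite graph

edgeCountedFromOneSide : ∀ si sj xi xj a → (a ≡ true → xi ≡ true → xj ≡ true → ⊥) →
                         𝟙 (si ∧ xi) * (𝟙 sj * 𝟙 a) + 𝟙 (sj ∧ xj) * (𝟙 si * 𝟙 a) ≤ 𝟙 si * (𝟙 sj * 𝟙 a)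
edgeCountedFromOneSide false false _     _     _     _ = z≤n
edgeCountedFromOneSide false true  _     false _     _ = z≤n
edgeCountedFromOneSide false true  _     true  _     _ = z≤n
edgeCountedFromOneSide true  false false _     _     _ = z≤n
edgeCountedFromOneSide true  false true  _     _     _ = z≤n
edgeCountedFromOneSide true  true  false false _     _ = z≤n
edgeCountedFromOneSide true  true  false true  false _ = z≤n
edgeCountedFromOneSide true  true  false true  true  _ = ≤-refl
edgeCountedFromOneSide true  true  true  false false _ = z≤n
edgeCountedFromOneSide true  true  true  false true  _ = ≤-refl
edgeCountedFromOneSide true  true  true  true  false _ = z≤n
edgeCountedFromOneSide true  true  true  true  true  h = ⊥-elim (h refl refl refl)

module _ {m} (G : Graph m) {x : Fin m → Bool} (x-indep : Independent G x) where

  2*degIn∩x≤degSum : ∀ s → 2 * sumOver (s ∩ x) (degIn G s) ≤ degSum G s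
  2*degIn∩x≤degSum s = begin
    2 * T                                                         ≡⟨ cong (T +_) (+-identityʳ T) ⟩
    T + T                                                         ≡⟨ cong₂ _+_ T≡∑w T≡∑wᵀ ⟩
    (∑[ i < m ] (∑[ j < m ] w i j)) + (∑[ i < m ] (∑[ j < m ] w j i)) ≡⟨ sym (∑-distrib-+ (λ i → ∑[ j < m ] w i j) _) ⟩
    ∑[ i < m ] (∑[ j < m ] w i j + ∑[ j < m ] w j i)              ≡⟨ sum-cong-≗ (λ i → sym (∑-distrib-+ (w i) (λ j → w j i))) ⟩
    ∑[ i < m ] (∑[ j < m ] (w i j + w j i))                       ≤⟨ ∑-mono-≤ (λ i → ∑-mono-≤ (pair i)) ⟩
    ∑[ i < m ] (∑[ j < m ] (𝟙 (s i) * (𝟙 (s j) * 𝟙 (adj G i j)))) ≡⟨ sum-cong-≗ (λ i → sym (*-distribˡ-sum (𝟙 (s i)) (λ j → 𝟙 (s j) * 𝟙 (adj G i j)))) ⟩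
    degSum G s                                                    ∎
    where
    open ≤-Reasoning
    T = sumOver (s ∩ x) (degIn G s)
    w : Fin m → Fin m → ℕ
    w i j = 𝟙 (s i ∧ x i) * (𝟙 (s j) * 𝟙 (adj G i j))
    T≡∑w : T ≡ ∑[ i < m ] (∑[ j < m ] w i j)
    T≡∑w = sum-cong-≗ (λ i → *-distribˡ-sum (𝟙 (s i ∧ x i)) (λ j → 𝟙 (s j) * 𝟙 (adj G i j)))
    T≡∑wᵀ : T ≡ ∑[ i < m ] (∑[ j < m ] w j i)
    T≡∑wᵀ = trans T≡∑w (∑-comm w)
    pair : ∀ i j → w i j + w j i ≤ 𝟙 (s i) * (𝟙 (s j) * 𝟙 (adj G i j))
    pair i j rewrite Graph.sym G j i = edgeCountedFromOneSide (s i) (s j) (x i) (x j) (adj G i j) (x-indep i j)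

[p+r+2]q+2≰2[q+p]+2rq : ∀ p q r → q ≤ p → r + 2 ≤ q → (p + r + 2) * q + 2 ≰ 2 * (q + p) + 2 * (r * q)
[p+r+2]q+2≰2[q+p]+2rq p q r q≤p r+2≤q with m≤n⇒∃[o]m+o≡n q≤p | m≤n⇒∃[o]m+o≡n r+2≤q
... | b , refl | a , refl = m+1+n≰m (2 * (q + p) + 2 * (r * q)) ∘ subst (_≤ 2 * (q + p) + 2 * (r * q)) (expand r a b)
  where
  expand : ∀ r a b → let q = r + 2 + a; p = q + b in
           (p + r + 2) * q + 2 ≡ 2 * (q + p) + 2 * (r * q) + suc (suc (2 * a + (r + a) * (a + b)))
  expand = solve-∀

module _ {m} (G : Graph m) {x y : Fin m → Bool} (y≗∁x : ∀ i → y i ≡ not (x i)) (x-indep : Independent G x)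
         {n} (|y|≡n : card y ≡ n) (deg≥ : ∀ v → n + 2 ≤ 2 * card (adj G v)) where

  x-neighbour∈y : ∀ {v j} → adj G v j ≡ true → x v ≡ true → y j ≡ true
  x-neighbour∈y {v} {j} vj xv with x j in xj
  ... | true  = ⊥-elim (x-indep v j vj xv xj)
  ... | false = trans (y≗∁x j) (cong not xj)

  deg≤degIn+card[y∖s] : ∀ s {v} → x v ≡ true → card (adj G v) ≤ degIn G s v + card (y ∩ (not ∘ s))
  deg≤degIn+card[y∖s] s {v} xv = ≤-trans (∑-mono-≤ split) (≤-reflexive (∑-distrib-+ (λ j → 𝟙 (s j) * 𝟙 (adj G v j)) _))
    where
    split : ∀ j → 𝟙 (adj G v j) * 1 ≤ 𝟙 (s j) * 𝟙 (adj G v j) + 𝟙 (y j ∧ not (s j)) * 1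
    split j with adj G v j in vj | s j
    ... | false | _     = z≤n
    ... | true  | true  = s≤s z≤n
    ... | true  | false rewrite x-neighbour∈y vj xv = ≤-refl

  forest≤-if-x-side-smaller : ∀ {s} → Acyclic G s → card (s ∩ x) ≤ card (s ∩ y) → card s ≤ suc n
  forest≤-if-x-side-smaller {s} acyclic q≤p with card s ≤? suc n
  ... | yes |s|≤1+n = |s|≤1+n
  ... | no  |s|≰1+n = contradiction counted ([p+r+2]q+2≰2[q+p]+2rq p q r q≤p r+2≤q)
    where
    open ≤-Reasoning
    q = card (s ∩ x)
    p = card (s ∩ y)
    r = card (y ∩ (not ∘ s))
    T = sumOver (s ∩ x) (degIn G s)

    |s|≡q+p : card s ≡ q + p
    |s|≡q+p = trans (card-split s x) (cong (q +_) (card-cong (λ i → cong (s i ∧_) (sym (y≗∁x i)))))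

    n≡p+r : n ≡ p + r
    n≡p+r = trans (sym |y|≡n) (trans (card-split y s) (cong (_+ r) (card-cong (λ i → ∧-comm (y i) (s i)))))

    n+2≤|s| : n + 2 ≤ card s
    n+2≤|s| = ≤-trans (≤-reflexive (+-comm n 2)) (≰⇒> |s|≰1+n)

    r+2≤q : r + 2 ≤ q
    r+2≤q = +-cancelˡ-≤ p _ _ (begin
      p + (r + 2) ≡⟨ sym (+-assoc p r 2) ⟩
      p + r + 2   ≡⟨ cong (_+ 2) (sym n≡p+r) ⟩
      n + 2       ≤⟨ n+2≤|s| ⟩
      card s      ≡⟨ |s|≡q+p ⟩
      q + p       ≡⟨ +-comm q p ⟩
      p + q       ∎)

    degreeCount : (n + 2) * q ≤ 2 * (T + r * q)
    degreeCount = begin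
      (n + 2) * q                                   ≡⟨ sym (sumOver-const (s ∩ x) (n + 2)) ⟩
      sumOver (s ∩ x) (λ _ → n + 2)                 ≤⟨ sumOver-mono (s ∩ x) vertexBound ⟩
      sumOver (s ∩ x) (λ i → 2 * (degIn G s i + r)) ≡⟨ sumOver-*ˡ (s ∩ x) 2 _ ⟩
      2 * sumOver (s ∩ x) (λ i → degIn G s i + r)   ≡⟨ cong (2 *_) (sumOver-+ (s ∩ x) (degIn G s) _) ⟩
      2 * (T + sumOver (s ∩ x) (λ _ → r))           ≡⟨ cong (λ c → 2 * (T + c)) (sumOver-const (s ∩ x) r) ⟩
      2 * (T + r * q)                               ∎
      where
      vertexBound : ∀ i → (s ∩ x) i ≡ true → n + 2 ≤ 2 * (degIn G s i + r)
      vertexBound i sxi = ≤-trans (deg≥ i) (*-monoʳ-≤ 2 (deg≤degIn+card[y∖s] s (∧-conicalʳ (s i) (x i) sxi)))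

    forestBound : 2 * T + 2 ≤ 2 * (q + p)
    forestBound = begin
      2 * T + 2        ≤⟨ +-monoˡ-≤ 2 (2*degIn∩x≤degSum G x-indep s) ⟩
      degSum G s + 2   ≤⟨ forest-degSum+2≤ G s acyclic (≤-trans (s≤s z≤n) (≰⇒> |s|≰1+n)) ⟩
      2 * card s       ≡⟨ cong (2 *_) |s|≡q+p ⟩
      2 * (q + p)      ∎

    counted : (p + r + 2) * q + 2 ≤ 2 * (q + p) + 2 * (r * q)
    counted = begin
      (p + r + 2) * q + 2       ≡⟨ cong (λ k → (k + 2) * q + 2) (sym n≡p+r) ⟩
      (n + 2) * q + 2           ≤⟨ +-monoˡ-≤ 2 degreeCount ⟩
      2 * (T + r * q) + 2       ≡⟨ regroup T (r * q) ⟩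
      2 * T + 2 + 2 * (r * q)   ≤⟨ +-monoˡ-≤ (2 * (r * q)) forestBound ⟩
      2 * (q + p) + 2 * (r * q) ∎
      where
      regroup : ∀ a b → 2 * (a + b) + 2 ≡ 2 * a + 2 + 2 * b
      regroup = solve-∀

balanced-forest≤ : ∀ {m} (G : Graph m) {x n} → Independent G x → Independent G (not ∘ x) →
                   card x ≡ n → card (not ∘ x) ≡ n → (∀ v → n + 2 ≤ 2 * card (adj G v)) →
                   ∀ {s} → Acyclic G s → card s ≤ suc n
balanced-forest≤ G {x} x-indep ∁x-indep |x|≡n |∁x|≡n deg≥ {s} acyclic with ≤-total (card (s ∩ x)) (card (s ∩ (not ∘ x)))
... | inj₁ x-smaller = forest≤-if-x-side-smaller G (λ _ → refl) x-indep |∁x|≡n deg≥ acyclic x-smaller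
... | inj₂ ∁x-smaller = forest≤-if-x-side-smaller G (λ i → sym (not-involutive (x i))) ∁x-indep |x|≡n deg≥ acyclic ∁x-smaller

-- Translation to subsets as bit vectors

∣tabulate∣≡card : ∀ {m} (s : Fin m → Bool) → ∣ tabulate s ∣ ≡ card s
∣tabulate∣≡card {zero}  s = refl
∣tabulate∣≡card {suc m} s with s zero
... | true  = cong suc (∣tabulate∣≡card (λ i → s (suc i)))
... | false = ∣tabulate∣≡card (λ i → s (suc i))

∣∣≡card : ∀ {m} (S : Subset m) → ∣ S ∣ ≡ card (lookup S)
∣∣≡card S = trans (cong ∣_∣ (sym (tabulate∘lookup S))) (∣tabulate∣≡card (lookup S))

∣∁∣≡card : ∀ {m} (S : Subset m) → ∣ ∁ S ∣ ≡ card (not ∘ lookup S)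
∣∁∣≡card S = trans (∣∣≡card (∁ S)) (card-cong (λ i → lookup-map i not S))

module _ {m} (G : Graph m) where

  InducesForest⇒Acyclic : ∀ S → InducesForest G S → Acyclic G (lookup S)
  InducesForest⇒Acyclic S forest (c , cycle , c⊆S) = forest (c , cycle , All.map (λ {i} → lookup⇒[]= i S) c⊆S)

  Acyclic⇒InducesForest : ∀ s → Acyclic G s → InducesForest G (tabulate s)
  Acyclic⇒InducesForest s acyclic (c , cycle , c⊆S) =
    acyclic (c , cycle , All.map (λ {i} i∈S → trans (sym (lookup∘tabulate s i)) ([]=⇒lookup i∈S)) c⊆S)

  ∈-Independent : ∀ P → (∀ u v → adj G u v ≡ true → u ∈ˢ P → v ∈ˢ P → ⊥) → Independent G (lookup P)
  ∈-Independent P P-indep u v e Pu Pv = P-indep u v e (lookup⇒[]= u P Pu) (lookup⇒[]= v P Pv)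

  ∉-Independent : ∀ P → (∀ u v → adj G u v ≡ true → ¬ u ∈ˢ P → ¬ v ∈ˢ P → ⊥) → Independent G (not ∘ lookup P)
  ∉-Independent P ∁P-indep u v e ∁Pu ∁Pv = ∁P-indep u v e (∉ ∁Pu) (∉ ∁Pv)
    where
    ∉ : ∀ {w} → not (lookup P w) ≡ true → ¬ w ∈ˢ P
    ∉ ∁Pw w∈P = contradiction (trans (sym (cong not ([]=⇒lookup w∈P))) ∁Pw) λ ()

theorem1 : (n : ℕ) → 1 ≤ n → (G : Graph (n + n)) →
    IsBalancedBipartite n G →
    (∀ v → n + 2 ≤ 2 * deg G v) →
    ForestNumber≡ G (suc n)
theorem1 n 1≤n G (P , |P|≡n , |∁P|≡n , P-indep , ∁P-indep) deg≥ = largeForest , noLargerForest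
  where
  x = lookup P
  |x|≡n : card x ≡ n
  |x|≡n = trans (sym (∣∣≡card P)) |P|≡n
  |∁x|≡n : card (not ∘ x) ≡ n
  |∁x|≡n = trans (sym (∣∁∣≡card P)) |∁P|≡n

  largeForest : Σ (Subset (n + n)) λ S → InducesForest G S × ∣ S ∣ ≡ suc n
  largeForest with u , xu ← card-nonempty x (subst (1 ≤_) (sym |x|≡n) 1≤n) =
    tabulate (⁅ u ⁆ ∪ (not ∘ x)) ,
    Acyclic⇒InducesForest G _ (⁅⁆∪independent-acyclic G u (∉-Independent G P ∁P-indep)) ,
    trans (∣tabulate∣≡card (⁅ u ⁆ ∪ (not ∘ x))) (trans (card-⁅⁆∪ u (not ∘ x) (cong not xu)) (cong suc |∁x|≡n))

  noLargerForest : ∀ S → InducesForest G S → ∣ S ∣ ≤ suc n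
  noLargerForest S forest = subst (_≤ suc n) (sym (∣∣≡card S))
    (balanced-forest≤ G (∈-Independent G P P-indep) (∉-Independent G P ∁P-indep) |x|≡n |∁x|≡n
       (λ v → subst (λ d → n + 2 ≤ 2 * d) (∣tabulate∣≡card (adj G v)) (deg≥ v))
       (InducesForest⇒Acyclic G S forest))
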